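{- Let $R$ be a set endowed with a D-structure $D$, and let $f:R^2\to R$ be an injection whose graph $\{(x,y,z)\mid f(x,y)=z\}$ belongs to $D$. Then a binary relation $A\subset R^2$ belongs to $D$ if and only if the unary relation $f(A)\subset R$ belongs to $D$.
   Context: A D-structure on a set $R$ is a collection of relations on $R$ (subsets of $R^n$, $n\ge1$) closed under the five operations: complement in $R^n$; union of two $n$-ary relations; permutation of coordinates ($A\mapsto\{(x_1,\dots,x_n)\mid (x_{i_1},\dots,x_{i_n})\in A\}$); set multiplication $A\mapsto A\times R$; projection $A\subset R^{n+1}\mapsto\{(x_1,\dots,x_n)\mid\exists x_{n+1}\in R\ (x_1,\dots,x_{n+1})\in A\}$. The D-structure generated by given relations is the smallest one containing them. -}

module Defs where

open import Data.Nat using (ℕ; zero; suc)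
open import Data.Fin using (Fin)
open import Data.Vec using (Vec; []; _∷_; _∷ʳ_; lookup; tabulate)
open import Data.Product using (Σ; _×_; _,_)
open import Data.Sum using (_⊎_)
open import Relation.Nullary using (¬_)
open import Relation.Binary.PropositionalEquality using (_≡_)
open import Function.Bundles using (_⇔_)
open import Data.Fin.Permutation using (Permutation′; _⟨$⟩ʳ_)

-- A (suc n)-ary relation on R (arities are always ≥ 1), as a predicate on R^(suc n).
Rel : Set → ℕ → Set₁
Rel R n = Vec R (suc n) → Set

initV : {R : Set} {n : ℕ} → Vec R (suc n) → Vec R n
initV (x ∷ [])       = []
initV (x ∷ (y ∷ xs)) = x ∷ initV (y ∷ xs)

complementR : {R : Set} {n : ℕ} → Rel R n → Rel R n
complementR A xs = ¬ A xs

unionR : {R : Set} {n : ℕ} → Rel R n → Rel R n → Rel R n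
unionR A B xs = A xs ⊎ B xs

permuteR : {R : Set} {n : ℕ} → Permutation′ (suc n) → Rel R n → Rel R n
permuteR σ A xs = A (tabulate (λ i → lookup xs (σ ⟨$⟩ʳ i)))

timesR : {R : Set} {n : ℕ} → Rel R n → Rel R (suc n)
timesR A xs = A (initV xs)

projR : {R : Set} {n : ℕ} → Rel R (suc n) → Rel R n
projR {R} A xs = Σ R (λ y → A (xs ∷ʳ y))

-- Since relations are predicates, "the collection is a
-- set of sets" is encoded by closure under extensional equality of relations.
record DStructure (R : Set) : Set₁ where
  field
    member   : (n : ℕ) → Rel R n → Set
    ext      : ∀ {n} (A B : Rel R n) → (∀ xs → A xs ⇔ B xs) → member n A → member n B
    closedC  : ∀ {n} (A : Rel R n) → member n A → member n (complementR A)
    closedU  : ∀ {n} (A B : Rel R n) → member n A → member n B → member n (unionR A B)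
    closedP  : ∀ {n} (σ : Permutation′ (suc n)) (A : Rel R n) → member n A → member n (permuteR σ A)
    closedT  : ∀ {n} (A : Rel R n) → member n A → member (suc n) (timesR A)
    closedPr : ∀ {n} (A : Rel R (suc n)) → member (suc n) A → member n (projR A)

graphR : {R : Set} → (R × R → R) → Rel R 2
graphR f (x ∷ y ∷ z ∷ []) = f (x , y) ≡ z

imageR : {R : Set} → (R × R → R) → Rel R 1 → Rel R 0
imageR {R} f A (z ∷ []) = Σ R (λ x → Σ R (λ y → A (x ∷ y ∷ []) × f (x , y) ≡ z))

module Submission where

-- Write f(A) for the image of a binary relation A and f⁻¹(C) for
-- the preimage {(x,y) | f(x,y) ∈ C} of a unary relation C.  Using only that the
-- graph Γ of f lies in D (and excluded middle, to get intersections from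
-- complements and unions), both transports stay inside D:
--   f(A)   = ∃x ∃y. (A × R)(x,y,z) ∧ Γ(x,y,z)     (rotate z to the front, project twice)
--   f⁻¹(C) = ∃z. (C × R × R)(z,x,y) ∧ Γ(x,y,z)    (rotate z to the back, project once)
-- When f is injective, f⁻¹(f(A)) = A, so f(A) ∈ D gives A ∈ D.

open import Defs
open import Data.Product using (_×_; _,_)
open import Data.Sum using (inj₁; inj₂)
open import Data.Empty using (⊥-elim)
open import Data.Fin using (Fin; zero; suc)
open import Data.Fin.Permutation using (Permutation′; permutation; flip)
open import Data.Vec using ([]; _∷_)
open import Function.Base using (id)
open import Function.Bundles using (_⇔_; mk⇔)
open import Function.Definitions using (Injective)
open import Relation.Binary.PropositionalEquality using (_≡_; refl)
open import Relation.Nullary using (yes; no)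
open import Axiom.ExcludedMiddle using (ExcludedMiddle)
open import Level using (0ℓ)

rotation : Permutation′ 3
rotation = permutation forward backward forward-backward backward-forward
  where
  forward backward : Fin 3 → Fin 3
  forward zero             = suc zero
  forward (suc zero)       = suc (suc zero)
  forward (suc (suc zero)) = zero
  backward zero             = suc (suc zero)
  backward (suc zero)       = zero
  backward (suc (suc zero)) = suc zero

  forward-backward : ∀ i → forward (backward i) ≡ i
  forward-backward zero             = refl
  forward-backward (suc zero)       = refl
  forward-backward (suc (suc zero)) = refl

  backward-forward : ∀ i → backward (forward i) ≡ i
  backward-forward zero             = refl
  backward-forward (suc zero)       = refl
  backward-forward (suc (suc zero)) = refl

preimageR : {R : Set} → (R × R → R) → Rel R 0 → Rel R 1
preimageR f C (x ∷ y ∷ []) = C (f (x , y) ∷ [])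

module _ (em : ExcludedMiddle 0ℓ) {R : Set} (D : DStructure R) where
  open DStructure D

  -- Intersections are in D: A ∩ B = ∁(∁A ∪ ∁B), which needs excluded middle.
  closedInter : ∀ {n} (A B : Rel R n) → member n A → member n B →
                member n (λ xs → A xs × B xs)
  closedInter A B mA mB =
    ext _ _ (λ xs → mk⇔ (deMorgan xs) (λ { (a , b) → λ { (inj₁ ¬a) → ¬a a ; (inj₂ ¬b) → ¬b b } }))
      (closedC _ (closedU _ _ (closedC A mA) (closedC B mB)))
    where
    deMorgan : ∀ xs → complementR (unionR (complementR A) (complementR B)) xs → A xs × B xs
    deMorgan xs h with em {A xs} | em {B xs}
    ... | yes a | yes b = a , b
    ... | no ¬a | _     = ⊥-elim (h (inj₁ ¬a))
    ... | _     | no ¬b = ⊥-elim (h (inj₂ ¬b))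

  closedRotateLeft : (A : Rel R 2) → member 2 A →
                     member 2 (λ { (x ∷ y ∷ z ∷ []) → A (y ∷ z ∷ x ∷ []) })
  closedRotateLeft A mA =
    ext _ _ (λ { (x ∷ y ∷ z ∷ []) → mk⇔ id id }) (closedP rotation A mA)

  closedRotateRight : (A : Rel R 2) → member 2 A →
                      member 2 (λ { (x ∷ y ∷ z ∷ []) → A (z ∷ x ∷ y ∷ []) })
  closedRotateRight A mA =
    ext _ _ (λ { (x ∷ y ∷ z ∷ []) → mk⇔ id id }) (closedP (flip rotation) A mA)

  module _ (f : R × R → R) (graphInD : member 2 (graphR f)) where

    closedImage : (A : Rel R 1) → member 1 A → member 0 (imageR f A)
    closedImage A mA =
      ext _ _ (λ { (z ∷ []) → mk⇔ id id })
        (closedPr _ (closedPr _ (closedRotateLeft _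
          (closedInter (timesR A) (graphR f) (closedT A mA) graphInD))))

    closedPreimage : (C : Rel R 0) → member 0 C → member 1 (preimageR f C)
    closedPreimage C mC =
      ext _ _ (λ { (x ∷ y ∷ []) → mk⇔ (λ { (_ , c , refl) → c }) (λ c → f (x , y) , c , refl) })
        (closedPr _ (closedInter _ (graphR f)
          (closedRotateRight _ (closedT _ (closedT C mC))) graphInD))

preimage-image : {R : Set} (f : R × R → R) → Injective _≡_ _≡_ f →
                 (A : Rel R 1) → ∀ xs → preimageR f (imageR f A) xs ⇔ A xs
preimage-image f inj A (x ∷ y ∷ []) = mk⇔ recover (λ a → x , y , a , refl)
  where
  recover : preimageR f (imageR f A) (x ∷ y ∷ []) → A (x ∷ y ∷ [])
  recover (x′ , y′ , a , e) with inj e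
  ... | refl = a

mainTheorem10 : ExcludedMiddle 0ℓ → (R : Set) (D : DStructure R) (f : R × R → R)
    → Injective _≡_ _≡_ f → DStructure.member D 2 (graphR f)
    → (A : Rel R 1) → DStructure.member D 1 A ⇔ DStructure.member D 0 (imageR f A)
mainTheorem10 em R D f inj graphInD A = mk⇔
  (closedImage em D f graphInD A)
  (λ imageInD → DStructure.ext D _ A (preimage-image f inj A)
                  (closedPreimage em D f graphInD (imageR f A) imageInD))
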